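{- Let $l$ be a positive integer, $U=U(P,Q)$ a $\Delta$-regular Lucas sequence, $p$ a prime with $p\nmid Q$, and $\rho=\rho_U(p)$. Let $n=\lambda\rho p^j-1$ with integers $j\geq0$, $\lambda\geq1$, $p\nmid\lambda$. Assume $\rho=p-\left(\frac{\Delta}{p}\right)$, $v_p(U_\rho)=1$ and $\max(\rho,p)\leq l<2\rho$. Then $v_p(C_{U,l}(n))\geq0$, except when $n=\rho-1$ and either $\rho=p=l$, or $\rho=p-1$ and $l=p$.
   Context: For nonzero integers $P,Q$, $U=U(P,Q)$: $U_0=0$, $U_1=1$, $U_{n+2}=PU_{n+1}-QU_n$; $\Delta=P^2-4Q$. $U$ is $\Delta$-regular if $U_n\neq0$ for all $n\geq1$, $\gcd(P,Q)=1$, $\Delta\neq0$. $\rho_U(p)$ is the least $n\geq1$ with $p\mid U_n$. $\left(\frac{\Delta}{p}\right)$ is the Legendre symbol (for $p=2$, the Kronecker symbol, which is $0$ when $\Delta$ is even). $n!_U=U_n\cdots U_1$, $0!_U=1$, and $C_{U,l}(n)=\frac{1}{U_{n+1}^l}\cdot\frac{((l+1)n)!_U}{(n!_U)^{l+1}}$. $v_p$ is the $p$-adic valuation on nonzero rationals. -}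

module Defs where

open import Data.Nat as ℕ using (ℕ; zero; suc)
open import Data.Integer as ℤ using (ℤ; +_; _-_; _*_; _^_)
open import Data.Integer.Divisibility using (_∣_)
open import Data.Integer.GCD using (gcd)
open import Data.Nat.Primality using (Prime)
open import Data.Product using (∃; _×_)
open import Data.Sum using (_⊎_)
open import Relation.Nullary using (¬_)
open import Relation.Binary.PropositionalEquality using (_≡_; _≢_)

U : ℤ → ℤ → ℕ → ℤ
U P Q zero = + 0
U P Q (suc zero) = + 1
U P Q (suc (suc n)) = P * U P Q (suc n) - Q * U P Q n

Disc : ℤ → ℤ → ℤ
Disc P Q = P * P - + 4 * Q

-- Δ-regular: U_n ≠ 0 for all n ≥ 1, gcd(P,Q) = 1, Δ ≠ 0
-- (P, Q nonzero is part of the standing assumptions)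
DeltaRegular : ℤ → ℤ → Set
DeltaRegular P Q =
  P ≢ + 0 × Q ≢ + 0 ×
  (∀ n → U P Q (suc n) ≢ + 0) × gcd P Q ≡ + 1 × Disc P Q ≢ + 0

IsRank : ℤ → ℤ → ℕ → ℕ → Set
IsRank P Q p ρ =
  1 ℕ.≤ ρ × (+ p) ∣ U P Q ρ × (∀ m → 1 ℕ.≤ m → m ℕ.< ρ → ¬ ((+ p) ∣ U P Q m))

IsSquareMod : ℕ → ℤ → Set
IsSquareMod p a = ∃ λ x → (+ p) ∣ (x * x - a)

-- LegendreSym p Δ e : e is the Legendre symbol (Δ/p) for odd p,
-- the Kronecker symbol (Δ/2) for p = 2.
data LegendreSym (p : ℕ) (a : ℤ) : ℤ → Set where
  odd-zero  : p ≢ 2 → (+ p) ∣ a → LegendreSym p a (+ 0)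
  odd-plus  : p ≢ 2 → ¬ ((+ p) ∣ a) → IsSquareMod p a → LegendreSym p a (+ 1)
  odd-minus : p ≢ 2 → ¬ ((+ p) ∣ a) → ¬ IsSquareMod p a → LegendreSym p a (ℤ.- + 1)
  two-zero  : p ≡ 2 → (+ 2) ∣ a → LegendreSym p a (+ 0)
  two-plus  : p ≡ 2 → ((+ 8) ∣ (a - + 1) ⊎ (+ 8) ∣ (a - + 7)) → LegendreSym p a (+ 1)
  two-minus : p ≡ 2 → ((+ 8) ∣ (a - + 3) ⊎ (+ 8) ∣ (a - + 5)) → LegendreSym p a (ℤ.- + 1)

fact : ℤ → ℤ → ℕ → ℤ
fact P Q zero = + 1
fact P Q (suc n) = U P Q (suc n) * fact P Q n

-- C_{U,l}(n) = Cnum / Cden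
Cnum : ℤ → ℤ → ℕ → ℕ → ℤ
Cnum P Q l n = fact P Q (suc l ℕ.* n)

Cden : ℤ → ℤ → ℕ → ℕ → ℤ
Cden P Q l n = (U P Q (suc n) ^ l) * (fact P Q n ^ suc l)

-- v_p(x) = k  (for nonzero x)
Val : ℕ → ℤ → ℕ → Set
Val p x k = ((+ p) ℤ.^ k) ∣ x × ¬ (((+ p) ℤ.^ suc k) ∣ x)

-- v_p(a/b) ≥ 0  ⇔  v_p(b) ≤ v_p(a)
ValNonneg : ℕ → ℤ → ℤ → Set
ValNonneg p a b = ∀ i k → Val p a i → Val p b k → k ℕ.≤ i

module Submission where

-- Write w(i) = v_p(U_i). Since p ∤ Q, p ∣ U_i iff ρ ∣ i, and for p ∣ U_m the lifting formula
-- U_{km} = U_m (k U_{m+1}^{k-1} + p x) shows that h(k) = w(kρ) depends only on v_p(k) and strictly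
-- increases with it, while h(1) = v_p(U_ρ) = 1. Telescoping gives h(k) = h(1) + Σ_b Δ_b [p^{b+1} ∣ k]
-- with all Δ_b ≥ 1. Put n + 1 = Nρ and M = (l+1)N - 2, so that (l+1)n = Mρ + (2ρ - l - 1) with
-- 0 ≤ 2ρ - l - 1 < ρ; only multiples of ρ contribute to the U-factorials, and
--   v_p(C_{U,l}(n)) = Σ_b Δ_b (⌊M/p^{b+1}⌋ - l [p^{b+1} ∣ N] - (l+1) ⌊(N-1)/p^{b+1}⌋) - h(1).
-- Every bracket is nonnegative, and it is positive for a power p^{b+1} in (N - 1, M] not dividing N;
-- as p ≤ l such a power exists unless N = 1 and l = p, which is the excluded case.

open import Data.Nat.Base as ℕ using (ℕ; suc)
open import Data.Nat.Primality using (Prime)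
open import Data.Integer.Base using (ℤ)
open import Relation.Binary.PropositionalEquality using (_≡_)

module Sum where
  open import Data.Nat
  open import Data.Nat.Properties
  open import Data.Nat.Divisibility
  open import Data.Nat.DivMod
  open import Data.Sum using (inj₁; inj₂)
  open import Function using (_∘_)
  open import Relation.Nullary using (Dec; yes; no; ¬_; contradiction)
  open import Relation.Binary.PropositionalEquality
  open import Algebra.Properties.CommutativeSemigroup +-commutativeSemigroup using (interchange)
  open ≡-Reasoning

  ∑ : ℕ → (ℕ → ℕ) → ℕ
  ∑ zero    f = 0
  ∑ (suc n) f = ∑ n f + f n

  syntax ∑ n (λ i → e) = ∑[ i < n ] e

  private
    below-suc : ∀ {n} {P : ℕ → Set} → (∀ i → i < suc n → P i) → ∀ i → i < n → P i
    below-suc h i i<n = h i (m<n⇒m<1+n i<n)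

  ∑-cong : ∀ n {f g : ℕ → ℕ} → (∀ i → i < n → f i ≡ g i) → ∑ n f ≡ ∑ n g
  ∑-cong zero    f≡g = refl
  ∑-cong (suc n) f≡g = cong₂ _+_ (∑-cong n (below-suc f≡g)) (f≡g n ≤-refl)

  ∑-mono-≤ : ∀ n {f g : ℕ → ℕ} → (∀ i → i < n → f i ≤ g i) → ∑ n f ≤ ∑ n g
  ∑-mono-≤ zero    f≤g = z≤n
  ∑-mono-≤ (suc n) f≤g = +-mono-≤ (∑-mono-≤ n (below-suc f≤g)) (f≤g n ≤-refl)

  ∑-mono-< : ∀ n {f g : ℕ → ℕ} → (∀ i → i < n → f i ≤ g i) →
             ∀ {k} → k < n → f k < g k → ∑ n f < ∑ n g
  ∑-mono-< (suc n) f≤g k<1+n fk<gk with m<1+n⇒m<n∨m≡n k<1+n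
  ... | inj₂ refl = +-mono-≤-< (∑-mono-≤ n (below-suc f≤g)) fk<gk
  ... | inj₁ k<n  = +-mono-<-≤ (∑-mono-< n (below-suc f≤g) k<n fk<gk) (f≤g n ≤-refl)

  ∑-distrib-+ : ∀ n (f g : ℕ → ℕ) → ∑[ i < n ] (f i + g i) ≡ ∑ n f + ∑ n g
  ∑-distrib-+ zero    f g = refl
  ∑-distrib-+ (suc n) f g =
    trans (cong (_+ (f n + g n)) (∑-distrib-+ n f g)) (interchange (∑ n f) (∑ n g) (f n) (g n))

  ∑-distribˡ-* : ∀ n c (f : ℕ → ℕ) → ∑[ i < n ] (c * f i) ≡ c * ∑ n f
  ∑-distribˡ-* zero    c f = sym (*-zeroʳ c)
  ∑-distribˡ-* (suc n) c f =
    trans (cong (_+ c * f n) (∑-distribˡ-* n c f)) (sym (*-distribˡ-+ c (∑ n f) (f n)))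

  ∑-const : ∀ n c → ∑[ i < n ] c ≡ n * c
  ∑-const zero    c = refl
  ∑-const (suc n) c = trans (cong (_+ c) (∑-const n c)) (+-comm (n * c) c)

  ∑-comm : ∀ m n (F : ℕ → ℕ → ℕ) → ∑[ i < m ] ∑[ j < n ] F i j ≡ ∑[ j < n ] ∑[ i < m ] F i j
  ∑-comm zero    n F = sym (trans (∑-const n 0) (*-zeroʳ n))
  ∑-comm (suc m) n F =
    trans (cong (_+ (∑[ j < n ] F m j)) (∑-comm m n F)) (sym (∑-distrib-+ n _ (F m)))

  ∑-telescope : ∀ (f : ℕ → ℕ) n → (∀ i → i < n → f i ≤ f (suc i)) →
                f n ≡ f 0 + ∑[ i < n ] (f (suc i) ∸ f i)
  ∑-telescope f zero    mono = sym (+-identityʳ (f 0))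
  ∑-telescope f (suc n) mono = begin
    f (suc n)
      ≡⟨ m+[n∸m]≡n (mono n ≤-refl) ⟨
    f n + (f (suc n) ∸ f n)
      ≡⟨ cong (_+ (f (suc n) ∸ f n)) (∑-telescope f n (below-suc mono)) ⟩
    f 0 + ∑[ i < n ] (f (suc i) ∸ f i) + (f (suc n) ∸ f n)
      ≡⟨ +-assoc (f 0) _ _ ⟩
    f 0 + ∑[ i < suc n ] (f (suc i) ∸ f i)
      ∎

  ∑-prefix : ∀ {m n} (f : ℕ → ℕ) → m ≤ n → (∀ i → m ≤ i → i < n → f i ≡ 0) → ∑ n f ≡ ∑ m f
  ∑-prefix {n = zero}  f z≤n    vanish = refl
  ∑-prefix {m} {suc n} f m≤1+n vanish with m≤n⇒m<n∨m≡n m≤1+n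
  ... | inj₂ refl  = refl
  ... | inj₁ m<1+n = begin
    ∑ n f + f n  ≡⟨ cong₂ _+_ (∑-prefix f m≤n (λ i m≤i → vanish i m≤i ∘ m<n⇒m<1+n)) (vanish n m≤n ≤-refl) ⟩
    ∑ m f + 0    ≡⟨ +-identityʳ (∑ m f) ⟩
    ∑ m f        ∎
    where m≤n = m<1+n⇒m≤n m<1+n

  ∑-multiples : ∀ {d r} (f : ℕ → ℕ) → (∀ i → ¬ d ∣ i → f i ≡ 0) → ∀ q → r < d →
                ∑[ i < q * d + r ] f (suc i) ≡ ∑[ k < q ] f (suc k * d)
  ∑-multiples {suc e} {r} f vanish q r<d = trans (drop-tail q r r<d) (blocks q)
    where
    d = suc e

    not-multiple : ∀ q {r} → suc r < d → ¬ d ∣ suc (q * d + r)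
    not-multiple q r<d d∣ = >⇒∤ r<d (∣m+n∣m⇒∣n (subst (d ∣_) (sym (+-suc (q * d) _)) d∣) (n∣m*n q))

    drop-tail : ∀ q r → r < d → ∑[ i < q * d + r ] f (suc i) ≡ ∑[ i < q * d ] f (suc i)
    drop-tail q zero    _   = cong (λ n → ∑ n (f ∘ suc)) (+-identityʳ (q * d))
    drop-tail q (suc r) r<d = begin
      ∑[ i < q * d + suc r ] f (suc i)
        ≡⟨ cong (λ n → ∑ n (f ∘ suc)) (+-suc (q * d) r) ⟩
      ∑[ i < q * d + r ] f (suc i) + f (suc (q * d + r))
        ≡⟨ cong₂ _+_ (drop-tail q r (<-trans (n<1+n r) r<d)) (vanish _ (not-multiple q r<d)) ⟩
      ∑[ i < q * d ] f (suc i) + 0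
        ≡⟨ +-identityʳ _ ⟩
      ∑[ i < q * d ] f (suc i)
        ∎

    blocks : ∀ q → ∑[ i < q * d ] f (suc i) ≡ ∑[ k < q ] f (suc k * d)
    blocks zero    = refl
    blocks (suc q) = begin
      ∑[ i < suc q * d ] f (suc i)                        ≡⟨ cong (λ n → ∑ n (f ∘ suc)) (sym last) ⟩
      ∑[ i < q * d + e ] f (suc i) + f (suc (q * d + e))  ≡⟨ cong₂ _+_ (drop-tail q e ≤-refl) (cong f last) ⟩
      ∑[ i < q * d ] f (suc i) + f (suc q * d)            ≡⟨ cong (_+ f (suc q * d)) (blocks q) ⟩
      ∑[ k < suc q ] f (suc k * d)                        ∎
      where last = cong suc (+-comm (q * d) e)

  𝟙 : ∀ {a} {A : Set a} → Dec A → ℕ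
  𝟙 (yes _) = 1
  𝟙 (no _)  = 0

  𝟙-yes : ∀ {a} {A : Set a} (d : Dec A) → A → 𝟙 d ≡ 1
  𝟙-yes (yes _) _ = refl
  𝟙-yes (no ¬a) a = contradiction a ¬a

  𝟙-no : ∀ {a} {A : Set a} (d : Dec A) → ¬ A → 𝟙 d ≡ 0
  𝟙-no (yes a) ¬a = contradiction a ¬a
  𝟙-no (no _)  _  = refl

  ∑-𝟙-∣ : ∀ d .{{_ : NonZero d}} X → ∑[ k < X ] 𝟙 (d ∣? suc k) ≡ X / d
  ∑-𝟙-∣ d X = begin
    ∑[ k < X ] 𝟙 (d ∣? suc k)
      ≡⟨ cong (λ n → ∑[ k < n ] 𝟙 (d ∣? suc k)) X≡ ⟩
    ∑[ k < X / d * d + X % d ] 𝟙 (d ∣? suc k)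
      ≡⟨ ∑-multiples (λ i → 𝟙 (d ∣? i)) (λ i → 𝟙-no (d ∣? i)) (X / d) (m%n<n X d) ⟩
    ∑[ k < X / d ] 𝟙 (d ∣? (suc k * d))
      ≡⟨ ∑-cong (X / d) (λ k _ → 𝟙-yes (d ∣? _) (n∣m*n (suc k))) ⟩
    ∑[ k < X / d ] 1
      ≡⟨ ∑-const (X / d) 1 ⟩
    X / d * 1
      ≡⟨ *-identityʳ (X / d) ⟩
    X / d
      ∎
    where X≡ = trans (m≡m%n+[m/n]*n X d) (+-comm (X % d) (X / d * d))

module Valuation (p : ℕ) (prime : Prime p) where
  open import Data.Nat
  open import Data.Nat.Properties
  open import Data.Nat.Divisibility
  open import Data.Nat.Induction using (<-rec)
  open import Data.Nat.Primality using (prime⇒nonZero; prime⇒nonTrivial; euclidsLemma)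
  open import Data.Product using (Σ; ∃-syntax; _×_; _,_)
  open import Data.Sum using ([_,_])
  open import Relation.Nullary using (¬_; yes; no; contradiction)
  open import Relation.Binary.PropositionalEquality using (_≡_; _≢_; refl; sym; trans; cong; subst; module ≡-Reasoning)

  instance
    p-nonZero : NonZero p
    p-nonZero = prime⇒nonZero prime

  1<p : 1 < p
  1<p = nonTrivial⇒n>1 p {{prime⇒nonTrivial prime}}

  p∤1 : ¬ p ∣ 1
  p∤1 p∣1 = <⇒≢ 1<p (sym (∣1⇒≡1 p∣1))

  n<p^n : ∀ n → n < p ^ n
  n<p^n zero    = z<s
  n<p^n (suc n) = begin-strict
    suc n           ≤⟨ n<p^n n ⟩
    p ^ n           <⟨ m<m*n (p ^ n) p {{m^n≢0 p n}} 1<p ⟩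
    p ^ n * p       ≡⟨ *-comm (p ^ n) p ⟩
    p ^ suc n       ∎
    where open ≤-Reasoning

  1<p^[1+b] : ∀ b → 1 < p ^ suc b
  1<p^[1+b] b = <-≤-trans 1<p (m≤m*n p (p ^ b) {{m^n≢0 p b}})

  ^-monoʳ-∣ : ∀ {m n} → m ≤ n → p ^ m ∣ p ^ n
  ^-monoʳ-∣ {m} {n} m≤n = divides (p ^ (n ∸ m)) (begin
    p ^ n                ≡⟨ cong (p ^_) (m∸n+n≡m m≤n) ⟨
    p ^ (n ∸ m + m)      ≡⟨ ^-distribˡ-+-* p (n ∸ m) m ⟩
    p ^ (n ∸ m) * p ^ m  ∎)
    where open ≡-Reasoning

  record IsValuation (x a : ℕ) : Set where
    constructor factorisation
    field
      unit     : ℕ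
      x≡p^a*u  : x ≡ p ^ a * unit
      p∤unit   : ¬ p ∣ unit

  p^∣⇒≤ : ∀ {x a k} → IsValuation x a → p ^ k ∣ x → k ≤ a
  p^∣⇒≤ {a = a} {k} (factorisation u refl p∤u) p^k∣ with k ≤? a
  ... | yes k≤a = k≤a
  ... | no  k≰a = contradiction (*-cancelˡ-∣ (p ^ a) {{m^n≢0 p a}} p^a*p∣p^a*u) p∤u
    where
    p^a*p∣p^a*u : p ^ a * p ∣ p ^ a * u
    p^a*p∣p^a*u = subst (_∣ p ^ a * u) (*-comm p (p ^ a)) (∣-trans (^-monoʳ-∣ (≰⇒> k≰a)) p^k∣)

  ≤⇒p^∣ : ∀ {x a k} → IsValuation x a → k ≤ a → p ^ k ∣ x
  ≤⇒p^∣ (factorisation u refl _) k≤a = ∣m⇒∣m*n u (^-monoʳ-∣ k≤a)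

  isValuation-unique : ∀ {x a b} → IsValuation x a → IsValuation x b → a ≡ b
  isValuation-unique va vb = ≤-antisym (p^∣⇒≤ vb (≤⇒p^∣ va ≤-refl)) (p^∣⇒≤ va (≤⇒p^∣ vb ≤-refl))

  ¬isValuation-0 : ∀ {a} → ¬ IsValuation 0 a
  ¬isValuation-0 {a} v = 1+n≰n (p^∣⇒≤ v ((p ^ suc a) ∣0))

  isValuation-1 : IsValuation 1 0
  isValuation-1 = factorisation 1 refl p∤1

  isValuation-* : ∀ {x y a b} → IsValuation x a → IsValuation y b → IsValuation (x * y) (a + b)
  isValuation-* {a = a} {b} (factorisation u refl p∤u) (factorisation v refl p∤v) =
    factorisation (u * v) (begin
      p ^ a * u * (p ^ b * v)  ≡⟨ interchange (p ^ a) u (p ^ b) v ⟩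
      p ^ a * p ^ b * (u * v)  ≡⟨ cong (_* (u * v)) (^-distribˡ-+-* p a b) ⟨
      p ^ (a + b) * (u * v)    ∎)
      ([ p∤u , p∤v ] ∘′ euclidsLemma u v prime)
    where
    open ≡-Reasoning
    open import Algebra.Properties.CommutativeSemigroup *-commutativeSemigroup using (interchange)
    open import Function using (_∘′_)

  isValuation-^ : ∀ {x a} → IsValuation x a → ∀ c → IsValuation (x ^ c) (c * a)
  isValuation-^ v zero    = isValuation-1
  isValuation-^ v (suc c) = isValuation-* v (isValuation-^ v c)

  valuation : ∀ x → x ≢ 0 → Σ ℕ (IsValuation x)
  valuation = <-rec _ step
    where
    step : ∀ x → (∀ {y} → y < x → y ≢ 0 → Σ ℕ (IsValuation y)) → x ≢ 0 → Σ ℕ (IsValuation x)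
    step x rec x≢0 with p ∣? x
    ... | no p∤x = 0 , factorisation x (sym (*-identityˡ x)) p∤x
    ... | yes (divides q refl) with rec q<q*p q≢0
      where
      q≢0 : q ≢ 0
      q≢0 refl = x≢0 refl
      q<q*p : q < q * p
      q<q*p = m<m*n q p {{≢-nonZero q≢0}} 1<p
    ...   | a , factorisation u refl p∤u =
      suc a , factorisation u (trans (*-comm (p ^ a * u) p) (sym (*-assoc p (p ^ a) u))) p∤u

  power-between : ∀ N → 1 ≤ N → ∃[ c ] N ≤ p ^ c × p ^ c < p * N
  power-between (suc zero)    _ = 0 , ≤-refl , subst (1 <_) (sym (*-identityʳ p)) 1<p
  power-between (suc (suc n)) _ with power-between (suc n) (s≤s z≤n)
  ... | c , N≤p^c , p^c<pN with suc (suc n) ≤? p ^ c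
  ...   | yes N+1≤p^c = c , N+1≤p^c , <-≤-trans p^c<pN (*-monoʳ-≤ p (n≤1+n (suc n)))
  ...   | no  N+1≰p^c = suc c , N+1≤p^[1+c] , p^[1+c]<p[N+1]
    where
    N≡p^c : suc n ≡ p ^ c
    N≡p^c = ≤-antisym N≤p^c (≤-pred (≰⇒> N+1≰p^c))
    N+1≤p^[1+c] : suc (suc n) ≤ p ^ suc c
    N+1≤p^[1+c] = subst (λ z → suc (suc n) ≤ p * z) N≡p^c (begin
      suc (suc n)       ≤⟨ s≤s (m≤n+m (suc n) n) ⟩
      suc n + suc n     ≡⟨ cong (suc n +_) (+-identityʳ (suc n)) ⟨
      2 * suc n         ≤⟨ *-monoˡ-≤ (suc n) 1<p ⟩
      p * suc n         ∎)
      where open ≤-Reasoning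
    p^[1+c]<p[N+1] : p ^ suc c < p * suc (suc n)
    p^[1+c]<p[N+1] = subst (λ z → p * z < p * suc (suc n)) N≡p^c (*-monoʳ-< p (n<1+n (suc n)))

module Floor where
  open import Data.Nat
  open import Data.Nat.Properties
  open import Data.Nat.Divisibility
  open import Data.Nat.DivMod
  open import Data.Nat.Tactic.RingSolver using (solve-∀)
  open import Relation.Nullary using (¬_; yes; no)
  open import Relation.Binary.PropositionalEquality using (_≡_; cong; subst)
  open Sum

  ≤⇒≤/ : ∀ {q d X} .{{_ : NonZero d}} → q * d ≤ X → q ≤ X / d
  ≤⇒≤/ {q} {d} qd≤X = subst (_≤ _) (m*n/n≡m q d) (/-monoˡ-≤ d qd≤X)

  -- One bracket of the Legendre-type sum, for d = p^(b+1), N = N' + 1 and M = (l + 1) N - 2.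
  floor-bound : ∀ {d l N' M} .{{_ : NonZero d}} → 2 ≤ d → 1 ≤ l → 2 + M ≡ suc l * suc N' →
                l * 𝟙 (d ∣? suc N') + suc l * (N' / d) ≤ M / d
  floor-bound {d} {l} {N'} {M} 2≤d 1≤l 2+M≡ with d ∣? suc N'
  ... | yes (divides q N≡qd) = ≤⇒≤/ (+-cancelʳ-≤ 2 _ _ (begin
    (l * 1 + suc l * c) * d + 2   ≤⟨ +-monoʳ-≤ _ 2≤d ⟩
    (l * 1 + suc l * c) * d + d   ≡⟨ identity l c d ⟩
    suc l * (suc c * d)           ≤⟨ *-monoʳ-≤ (suc l) (*-monoˡ-≤ d c<q) ⟩
    suc l * (q * d)               ≡⟨ cong (suc l *_) N≡qd ⟨
    suc l * suc N'                ≡⟨ 2+M≡ ⟨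
    2 + M                         ≡⟨ +-comm 2 M ⟩
    M + 2                         ∎))
    where
    open ≤-Reasoning
    c = N' / d
    c<q : c < q
    c<q = *-cancelʳ-< d c q (≤-<-trans (m/n*n≤m N' d) (subst (N' <_) N≡qd ≤-refl))
    identity : ∀ l c d → (l * 1 + suc l * c) * d + d ≡ suc l * (suc c * d)
    identity = solve-∀
  ... | no _ = ≤⇒≤/ (+-cancelʳ-≤ 2 _ _ (begin
    (l * 0 + suc l * c) * d + 2   ≡⟨ cong (_+ 2) (identity l c d) ⟩
    suc l * (c * d) + 2           ≤⟨ +-mono-≤ (*-monoʳ-≤ (suc l) (m/n*n≤m N' d)) (s≤s 1≤l) ⟩
    suc l * N' + suc l            ≡⟨ *-suc-comm l N' ⟩
    suc l * suc N'                ≡⟨ 2+M≡ ⟨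
    2 + M                         ≡⟨ +-comm 2 M ⟩
    M + 2                         ∎))
    where
    open ≤-Reasoning
    c = N' / d
    identity : ∀ l c d → (l * 0 + suc l * c) * d ≡ suc l * (c * d)
    identity = solve-∀
    *-suc-comm : ∀ l n → suc l * n + suc l ≡ suc l * suc n
    *-suc-comm = solve-∀

  floor-bound-strict : ∀ {d l N' M} .{{_ : NonZero d}} → N' < d → d ≤ M → ¬ d ∣ suc N' →
                       l * 𝟙 (d ∣? suc N') + suc l * (N' / d) < M / d
  floor-bound-strict {d} {l} {N'} {M} N'<d d≤M d∤N
    rewrite 𝟙-no (d ∣? suc N') d∤N | m<n⇒m/n≡0 N'<d | *-zeroʳ l = m≥n⇒m/n>0 d≤M

module LegendreInequality (p : ℕ) (prime : Prime p) (h : ℕ → ℕ)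
  (h-val  : ∀ {k a} → Valuation.IsValuation p prime k a → h k ≡ h (p ℕ.^ a))
  (h-step : ∀ a → h (p ℕ.^ a) ℕ.< h (p ℕ.^ suc a))
  (h-1    : h 1 ℕ.≤ 1) where
  open import Data.Nat
  open import Data.Nat.Properties
  open import Data.Nat.Divisibility
  open import Data.Nat.Tactic.RingSolver using (solve-∀)
  open import Data.Product using (_,_; ∃-syntax; _×_)
  open import Data.Sum using (inj₁; inj₂)
  open import Relation.Nullary using (¬_)
  open import Relation.Binary.PropositionalEquality
  open Sum
  open Floor
  open Valuation p prime
  open import Data.Nat.DivMod using (_/_)

  _/p^_ : ℕ → ℕ → ℕ
  X /p^ a = _/_ X (p ^ a) {{m^n≢0 p a}}

  Δh : ℕ → ℕ
  Δh b = h (p ^ suc b) ∸ h (p ^ b)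

  Δh>0 : ∀ b → 0 < Δh b
  Δh>0 b = m<n⇒0<n∸m (h-step b)

  h-p^ : ∀ a → h (p ^ a) ≡ h 1 + ∑[ b < a ] Δh b
  h-p^ a = ∑-telescope (λ b → h (p ^ b)) a (λ b _ → <⇒≤ (h-step b))

  h≡∑ : ∀ {k} B → k ≢ 0 → k ≤ B → h k ≡ h 1 + ∑[ b < B ] (Δh b * 𝟙 (p ^ suc b ∣? k))
  h≡∑ {k} B k≢0 k≤B with valuation k k≢0
  ... | a , v = begin
    h k                                         ≡⟨ h-val v ⟩
    h (p ^ a)                                   ≡⟨ h-p^ a ⟩
    h 1 + ∑[ b < a ] Δh b                       ≡⟨ cong (h 1 +_) (∑-cong a below) ⟨
    h 1 + ∑[ b < a ] (Δh b * 𝟙 (p ^ suc b ∣? k))  ≡⟨ cong (h 1 +_) (∑-prefix _ a≤B above) ⟨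
    h 1 + ∑[ b < B ] (Δh b * 𝟙 (p ^ suc b ∣? k))  ∎
    where
    open ≡-Reasoning
    below : ∀ b → b < a → Δh b * 𝟙 (p ^ suc b ∣? k) ≡ Δh b
    below b b<a = trans (cong (Δh b *_) (𝟙-yes _ (≤⇒p^∣ v b<a))) (*-identityʳ (Δh b))
    above : ∀ b → a ≤ b → b < B → Δh b * 𝟙 (p ^ suc b ∣? k) ≡ 0
    above b a≤b _ =
      trans (cong (Δh b *_) (𝟙-no _ (λ p^[1+b]∣k → <⇒≱ (p^∣⇒≤ v p^[1+b]∣k) a≤b))) (*-zeroʳ (Δh b))
    a≤B : a ≤ B
    a≤B = ≤-trans (<⇒≤ (n<p^n a)) (≤-trans (∣⇒≤ {{≢-nonZero k≢0}} (≤⇒p^∣ v ≤-refl)) k≤B)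

  ∑h : ∀ B X → X ≤ B → ∑[ k < X ] h (suc k) ≡ X * h 1 + ∑[ b < B ] (Δh b * (X /p^ suc b))
  ∑h B X X≤B = begin
    ∑[ k < X ] h (suc k)
      ≡⟨ ∑-cong X (λ k k<X → h≡∑ B (λ ()) (≤-trans k<X X≤B)) ⟩
    ∑[ k < X ] (h 1 + ∑[ b < B ] (Δh b * 𝟙 (p ^ suc b ∣? suc k)))
      ≡⟨ ∑-distrib-+ X _ _ ⟩
    ∑[ k < X ] h 1 + ∑[ k < X ] ∑[ b < B ] (Δh b * 𝟙 (p ^ suc b ∣? suc k))
      ≡⟨ cong₂ _+_ (∑-const X (h 1)) (∑-comm X B _) ⟩
    X * h 1 + ∑[ b < B ] ∑[ k < X ] (Δh b * 𝟙 (p ^ suc b ∣? suc k))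
      ≡⟨ cong (X * h 1 +_) (∑-cong B count) ⟩
    X * h 1 + ∑[ b < B ] (Δh b * (X /p^ suc b))
      ∎
    where
    open ≡-Reasoning
    count : ∀ b → b < B → ∑[ k < X ] (Δh b * 𝟙 (p ^ suc b ∣? suc k)) ≡ Δh b * (X /p^ suc b)
    count b _ = trans (∑-distribˡ-* X (Δh b) _) (cong (Δh b *_) (∑-𝟙-∣ (p ^ suc b) {{m^n≢0 p (suc b)}} X))

  gap-power : ∀ {l N' M} → p ≤ l → (N' ≡ 0 → l ≢ p) → 2 + M ≡ suc l * suc N' →
              ∃[ b ] N' < p ^ suc b × p ^ suc b ≤ M × ¬ p ^ suc b ∣ suc N'
  gap-power {l} {N'} {M} p≤l exception 2+M≡ with power-between (suc N') (s≤s z≤n)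
  ... | c , N≤p^c , p^c<pN with m≤n⇒m<n∨m≡n N≤p^c
  ...   | inj₁ N<p^c = smaller c N<p^c p^c<pN
    where
    open ≤-Reasoning
    smaller : ∀ c → suc N' < p ^ c → p ^ c < p * suc N' →
              ∃[ b ] N' < p ^ suc b × p ^ suc b ≤ M × ¬ p ^ suc b ∣ suc N'
    smaller zero    (s≤s ())
    smaller (suc b) N<p^[1+b] p^[1+b]<pN =
      b , <-trans (n<1+n N') N<p^[1+b] , p^[1+b]≤M , >⇒∤ N<p^[1+b]
      where
      p^[1+b]≤M : p ^ suc b ≤ M
      p^[1+b]≤M = ≤-pred (≤-pred (begin
        2 + p ^ suc b          ≤⟨ s≤s p^[1+b]<pN ⟩
        suc (p * suc N')       ≤⟨ s≤s (*-monoˡ-≤ (suc N') p≤l) ⟩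
        suc (l * suc N')       ≤⟨ +-monoˡ-≤ (l * suc N') (s≤s z≤n) ⟩
        suc N' + l * suc N'    ≡⟨ 2+M≡ ⟨
        2 + M                  ∎))
  ...   | inj₂ N≡p^c = c , <-trans (n<1+n N') N<pN , pN≤M , >⇒∤ N<pN
    where
    open ≤-Reasoning
    N<pN : suc N' < p ^ suc c
    N<pN = subst (λ x → suc N' < p * x) N≡p^c (subst (suc N' <_) (*-comm (suc N') p) (m<m*n (suc N') p 1<p))
    2+pN≤[1+l]N : ∀ {n} → (n ≡ 0 → l ≢ p) → 2 + p * suc n ≤ suc n + l * suc n
    2+pN≤[1+l]N {zero} exception = subst₂ (λ x y → 2 + x ≤ 1 + y) (sym (*-identityʳ p)) (sym (*-identityʳ l))
      (s≤s (≤∧≢⇒< p≤l (λ p≡l → exception refl (sym p≡l))))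
    2+pN≤[1+l]N {suc n} _ = begin
      2 + p * suc (suc n)                ≤⟨ +-monoˡ-≤ (p * suc (suc n)) (s≤s (s≤s z≤n)) ⟩
      suc (suc n) + p * suc (suc n)      ≤⟨ +-monoʳ-≤ (suc (suc n)) (*-monoˡ-≤ (suc (suc n)) p≤l) ⟩
      suc (suc n) + l * suc (suc n)      ∎
    pN≤M : p ^ suc c ≤ M
    pN≤M = ≤-pred (≤-pred (begin
      2 + p * p ^ c          ≡⟨ cong (λ x → 2 + p * x) N≡p^c ⟨
      2 + p * suc N'         ≤⟨ 2+pN≤[1+l]N exception ⟩
      suc N' + l * suc N'    ≡⟨ 2+M≡ ⟨
      2 + M                  ∎))

  legendre-inequality : ∀ {l N' M} → p ≤ l → (N' ≡ 0 → l ≢ p) → 2 + M ≡ suc l * suc N' →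
    l * h (suc N') + suc l * ∑[ k < N' ] h (suc k) ≤ ∑[ k < M ] h (suc k)
  -- Termwise den b ≤ ⌊M / p^(b+1)⌋, strictly at the gap power b₀, which pays for the extra h 1.
  legendre-inequality {l} {N'} {M} p≤l exception 2+M≡ with gap-power p≤l exception 2+M≡
  ... | b₀ , N'<p^[1+b₀] , p^[1+b₀]≤M , p^[1+b₀]∤N = begin
    l * h (suc N') + suc l * ∑[ k < N' ] h (suc k)
      ≡⟨ cong₂ (λ x y → l * x + suc l * y) (h≡∑ M (λ ()) N≤M) (∑h M N' (<⇒≤ N≤M)) ⟩
    l * (h 1 + A) + suc l * (N' * h 1 + B)
      ≡⟨ rearrange l N' (h 1) A B ⟩
    (l + suc l * N') * h 1 + (l * A + suc l * B)
      ≡⟨ cong₂ (λ x y → x * h 1 + y) l+[1+l]N'≡1+M (sym ∑-den) ⟩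
    suc M * h 1 + ∑[ b < M ] (Δh b * den b)
      ≡⟨ +-assoc (h 1) (M * h 1) _ ⟩
    h 1 + (M * h 1 + ∑[ b < M ] (Δh b * den b))
      ≡⟨ x+[y+z]≡y+[x+z] (h 1) (M * h 1) _ ⟩
    M * h 1 + (h 1 + ∑[ b < M ] (Δh b * den b))
      ≤⟨ +-monoʳ-≤ (M * h 1) (≤-trans (+-monoˡ-≤ _ h-1) ∑den<∑num) ⟩
    M * h 1 + ∑[ b < M ] (Δh b * (M /p^ suc b))
      ≡⟨ ∑h M M ≤-refl ⟨
    ∑[ k < M ] h (suc k)
      ∎
    where
    open ≤-Reasoning
    A = ∑[ b < M ] (Δh b * 𝟙 (p ^ suc b ∣? suc N'))
    B = ∑[ b < M ] (Δh b * (N' /p^ suc b))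

    den : ℕ → ℕ
    den b = l * 𝟙 (p ^ suc b ∣? suc N') + suc l * (N' /p^ suc b)

    N≤M : suc N' ≤ M
    N≤M = <-≤-trans N'<p^[1+b₀] p^[1+b₀]≤M

    rearrange : ∀ l n h a b → l * (h + a) + suc l * (n * h + b) ≡ (l + suc l * n) * h + (l * a + suc l * b)
    rearrange = solve-∀

    x+[y+z]≡y+[x+z] : ∀ x y z → x + (y + z) ≡ y + (x + z)
    x+[y+z]≡y+[x+z] = solve-∀

    l+[1+l]N'≡1+M : l + suc l * N' ≡ suc M
    l+[1+l]N'≡1+M = trans (identity l N') (sym (suc-injective 2+M≡))
      where
      identity : ∀ l n → l + suc l * n ≡ n + l * suc n
      identity = solve-∀

    ∑-den : ∑[ b < M ] (Δh b * den b) ≡ l * A + suc l * B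
    ∑-den = trans (∑-cong M (λ b _ → distrib l (Δh b) _ _))
           (trans (∑-distrib-+ M _ _) (cong₂ _+_ (∑-distribˡ-* M l _) (∑-distribˡ-* M (suc l) _)))
      where
      distrib : ∀ l x i c → x * (l * i + suc l * c) ≡ l * (x * i) + suc l * (x * c)
      distrib = solve-∀

    1≤l : 1 ≤ l
    1≤l = ≤-trans (<⇒≤ 1<p) p≤l

    den≤ : ∀ b → b < M → Δh b * den b ≤ Δh b * (M /p^ suc b)
    den≤ b _ = *-monoʳ-≤ (Δh b) (floor-bound {{m^n≢0 p (suc b)}} (1<p^[1+b] b) 1≤l 2+M≡)

    den<ₒ : Δh b₀ * den b₀ < Δh b₀ * (M /p^ suc b₀)
    den<ₒ = *-monoʳ-< (Δh b₀) {{>-nonZero (Δh>0 b₀)}}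
              (floor-bound-strict {l = l} {{m^n≢0 p (suc b₀)}} N'<p^[1+b₀] p^[1+b₀]≤M p^[1+b₀]∤N)

    ∑den<∑num : ∑[ b < M ] (Δh b * den b) < ∑[ b < M ] (Δh b * (M /p^ suc b))
    ∑den<∑num = ∑-mono-< M den≤ {b₀} (<⇒≤ (<-≤-trans (n<p^n (suc b₀)) p^[1+b₀]≤M)) den<ₒ

module Lucas (P Q : ℤ) where
  open import Defs
  open import Data.Nat as ℕ using (ℕ; zero; suc; _≤_; _<_)
  import Data.Nat.Properties as ℕ
  import Data.Nat.Divisibility as ℕ
  open import Data.Nat.Divisibility using () renaming (_∣_ to _∣ℕ_)
  open import Data.Nat.Induction using (<-rec)
  open import Data.Nat.Primality using (euclidsLemma)
  open import Data.Integer using (ℤ; +_; _+_; _-_; _*_; _^_; ∣_∣; 0ℤ; 1ℤ)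
  open import Data.Integer.Properties using (abs-*; *-comm)
  open import Data.Integer.Divisibility using (_∣_)
  import Data.Integer.Divisibility.Signed as Signed
  open import Data.Integer.Tactic.RingSolver using (solve-∀)
  open import Data.Product using (_×_; _,_; ∃₂)
  open import Data.Sum using (_⊎_; inj₁; inj₂)
  open import Function using (_∘_)
  open import Relation.Nullary using (¬_; yes; no; contradiction)
  open import Relation.Binary.PropositionalEquality
  open ≡-Reasoning

  ∣m∣n⇒∣m-n : ∀ k x y → k ∣ x → k ∣ y → k ∣ x - y
  ∣m∣n⇒∣m-n k x y k∣x k∣y =
    Signed.∣⇒∣ᵤ {k} {x - y} (Signed.∣m∣n⇒∣m-n (Signed.∣ᵤ⇒∣ {k} {x} k∣x) (Signed.∣ᵤ⇒∣ {k} {y} k∣y))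

  ∣m+n∣n⇒∣m : ∀ k x y → k ∣ x + y → k ∣ y → k ∣ x
  ∣m+n∣n⇒∣m k x y k∣x+y k∣y =
    Signed.∣⇒∣ᵤ {k} {x} (Signed.∣m+n∣n⇒∣m (Signed.∣ᵤ⇒∣ {k} {x + y} k∣x+y) (Signed.∣ᵤ⇒∣ {k} {y} k∣y))

  ∣n⇒∣m*n : ∀ k x y → k ∣ y → k ∣ x * y
  ∣n⇒∣m*n k x y k∣y = subst (∣ k ∣ ∣ℕ_) (sym (abs-* x y)) (ℕ.∣n⇒∣m*n ∣ x ∣ k∣y)

  u : ℕ → ℤ
  u = U P Q

  U-+ : ∀ a s → u (suc (a ℕ.+ s)) ≡ u (suc a) * u (suc s) - Q * u a * u s
  U-+ zero          s = identity Q (u (suc s)) (u s)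
    where
    identity : ∀ Q A B → A ≡ 1ℤ * A - Q * 0ℤ * B
    identity = solve-∀
  U-+ (suc zero)    s = identity P Q (u (suc s)) (u s)
    where
    identity : ∀ P Q A B → P * A - Q * B ≡ (P * 1ℤ - Q * 0ℤ) * A - Q * 1ℤ * B
    identity = solve-∀
  U-+ (suc (suc a)) s = begin
    P * u (suc (suc (a ℕ.+ s))) - Q * u (suc (a ℕ.+ s))
      ≡⟨ cong₂ (λ x y → P * x - Q * y) (U-+ (suc a) s) (U-+ a s) ⟩
    P * (u (suc (suc a)) * u (suc s) - Q * u (suc a) * u s) - Q * (u (suc a) * u (suc s) - Q * u a * u s)
      ≡⟨ identity P Q (u (suc a)) (u a) (u (suc s)) (u s) ⟩
    u (suc (suc (suc a))) * u (suc s) - Q * u (suc (suc a)) * u s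
      ∎
    where
    identity : ∀ P Q x y A B →
      P * ((P * x - Q * y) * A - Q * x * B) - Q * (x * A - Q * y * B)
      ≡ (P * (P * x - Q * y) - Q * x) * A - Q * (P * x - Q * y) * B
    identity = solve-∀

  module AtPrime (p : ℕ) (prime : Prime p) where
    open Valuation p prime

    p∣*⇒p∣⊎p∣ : ∀ x y → + p ∣ x * y → (+ p ∣ x) ⊎ (+ p ∣ y)
    p∣*⇒p∣⊎p∣ x y p∣xy = euclidsLemma ∣ x ∣ ∣ y ∣ prime (subst (p ∣ℕ_) (abs-* x y) p∣xy)

    p∣^⇒p∣ : ∀ x k → + p ∣ x ^ k → + p ∣ x
    p∣^⇒p∣ x zero    p∣1 = contradiction p∣1 p∤1
    p∣^⇒p∣ x (suc k) p∣xx^k with p∣*⇒p∣⊎p∣ x (x ^ k) p∣xx^k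
    ... | inj₁ p∣x   = p∣x
    ... | inj₂ p∣x^k = p∣^⇒p∣ x k p∣x^k

    module Lifting (s : ℕ) (p∣u[1+s] : + p ∣ u (suc s)) where
      m = suc s
      A = u (suc m)

      private
        p∣um : + p Signed.∣ u m
        p∣um = Signed.∣ᵤ⇒∣ {+ p} {u m} p∣u[1+s]
        c : ℤ
        c = Signed.quotient p∣um
        um≡pc : u m ≡ + p * c
        um≡pc = trans (Signed._∣_.equality p∣um) (*-comm c (+ p))

        step-U : ∀ {um} us B K x y → um ≡ + p * c → let A = P * um - Q * us in
          (A * B + + p * y) * um - Q * (um * (K * B + + p * x)) * us
          ≡ um * ((1ℤ + K) * (A * B) + + p * (y - P * c * (K * B + + p * x) + A * x))
        step-U us B K x y refl = identity P Q us c (+ p) B K x y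
          where
          identity : ∀ P Q us c p B K x y → let um = p * c; A = P * um - Q * us in
            (A * B + p * y) * um - Q * (um * (K * B + p * x)) * us
            ≡ um * ((1ℤ + K) * (A * B) + p * (y - P * c * (K * B + p * x) + A * x))
          identity = solve-∀

        step-U₊₁ : ∀ {um} A B K x y → um ≡ + p * c →
          (A * B + + p * y) * A - Q * (um * (K * B + + p * x)) * um
          ≡ A * (A * B) + + p * (y * A - Q * c * (K * B + + p * x) * um)
        step-U₊₁ A B K x y refl = identity Q A c (+ p) B K x y
          where
          identity : ∀ Q A c p B K x y → let um = p * c in
            (A * B + p * y) * A - Q * (um * (K * B + p * x)) * um
            ≡ A * (A * B) + p * (y * A - Q * c * (K * B + p * x) * um)
          identity = solve-∀

      lift : ∀ k → ∃₂ λ x y → u (suc k ℕ.* m) ≡ u m * (+ suc k * A ^ k + + p * x)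
                            × u (suc (suc k ℕ.* m)) ≡ A ^ suc k + + p * y
      lift zero = + 0 , + 0 , trans (cong u (ℕ.+-identityʳ m)) (base (u m) (+ p))
                            , trans (cong (u ∘ suc) (ℕ.+-identityʳ m)) (base′ A (+ p))
        where
        base : ∀ um p → um ≡ um * (+ 1 * 1ℤ + p * + 0)
        base = solve-∀
        base′ : ∀ A p → A ≡ A * 1ℤ + p * + 0
        base′ = solve-∀
      lift (suc k) with lift k
      ... | x , y , eX , eY = _ , _ , eX′ , eY′
        where
        a = suc k ℕ.* m
        K = + suc k
        B = A ^ k
        eX′ : u (m ℕ.+ a) ≡ u m * (+ suc (suc k) * A ^ suc k + + p * (y - P * c * (K * B + + p * x) + A * x))
        eX′ = begin
          u (m ℕ.+ a)                                         ≡⟨ cong (u ∘ suc) (ℕ.+-comm s a) ⟩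
          u (suc (a ℕ.+ s))                                   ≡⟨ U-+ a s ⟩
          u (suc a) * u m - Q * u a * u s                     ≡⟨ cong₂ (λ X Y → Y * u m - Q * X * u s) eX eY ⟩
          (A * B + + p * y) * u m - Q * (u m * (K * B + + p * x)) * u s
            ≡⟨ step-U (u s) B K x y um≡pc ⟩
          u m * (+ suc (suc k) * A ^ suc k + + p * (y - P * c * (K * B + + p * x) + A * x)) ∎
        eY′ : u (suc (m ℕ.+ a)) ≡ A ^ suc (suc k) + + p * (y * A - Q * c * (K * B + + p * x) * u m)
        eY′ = begin
          u (suc (m ℕ.+ a))                                   ≡⟨ cong (u ∘ suc) (ℕ.+-comm m a) ⟩
          u (suc (a ℕ.+ m))                                   ≡⟨ U-+ a m ⟩
          u (suc a) * A - Q * u a * u m                       ≡⟨ cong₂ (λ X Y → Y * A - Q * X * u m) eX eY ⟩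
          (A * B + + p * y) * A - Q * (u m * (K * B + + p * x)) * u m
            ≡⟨ step-U₊₁ A B K x y um≡pc ⟩
          A ^ suc (suc k) + + p * (y * A - Q * c * (K * B + + p * x) * u m) ∎

    module Rank (p∤Q : ¬ (+ p ∣ Q)) (s : ℕ) (rank : IsRank P Q p (suc s)) where
      open import Data.Product using (proj₁; proj₂)

      ρ = suc s

      p∣uρ : + p ∣ u ρ
      p∣uρ = proj₁ (proj₂ rank)

      1≤s : 1 ≤ s
      1≤s = positive s p∣uρ
        where
        positive : ∀ s → + p ∣ u (suc s) → 1 ≤ s
        positive zero    p∣1 = contradiction p∣1 p∤1
        positive (suc _) _   = ℕ.s≤s ℕ.z≤n

      p∤us : ¬ (+ p ∣ u s)
      p∤us = proj₂ (proj₂ rank) s 1≤s (ℕ.n<1+n s)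

      p∣Q*ua*us : ∀ a → + p ∣ u (suc (a ℕ.+ s)) → + p ∣ Q * u a * u s
      p∣Q*ua*us a p∣ = subst (+ p ∣_) difference 
        (∣m∣n⇒∣m-n (+ p) (u (suc a) * u ρ) (u (suc (a ℕ.+ s))) (∣n⇒∣m*n (+ p) (u (suc a)) (u ρ) p∣uρ) p∣)
        where
        x-[x-y]≡y : ∀ x y → x - (x - y) ≡ y
        x-[x-y]≡y = solve-∀
        difference : u (suc a) * u ρ - u (suc (a ℕ.+ s)) ≡ Q * u a * u s
        difference = trans (cong (u (suc a) * u ρ -_) (U-+ a s)) (x-[x-y]≡y (u (suc a) * u ρ) (Q * u a * u s))

      p∣u[a+ρ]⇒p∣ua : ∀ a → + p ∣ u (suc (a ℕ.+ s)) → + p ∣ u a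
      p∣u[a+ρ]⇒p∣ua a p∣ with p∣*⇒p∣⊎p∣ (Q * u a) (u s) (p∣Q*ua*us a p∣)
      ... | inj₂ p∣us  = contradiction p∣us p∤us
      ... | inj₁ p∣Qua with p∣*⇒p∣⊎p∣ Q (u a) p∣Qua
      ...   | inj₁ p∣Q  = contradiction p∣Q p∤Q
      ...   | inj₂ p∣ua = p∣ua

      rank-divides : ∀ i → + p ∣ u i → ρ ∣ℕ i
      rank-divides = <-rec _ step
        where
        step : ∀ i → (∀ {j} → j < i → + p ∣ u j → ρ ∣ℕ j) → + p ∣ u i → ρ ∣ℕ i
        step zero    _   _   = ρ ℕ.∣0
        step (suc i) rec p∣ with suc i ℕ.<? ρ
        ... | yes i<ρ = contradiction p∣ (proj₂ (proj₂ rank) (suc i) (ℕ.s≤s ℕ.z≤n) i<ρ)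
        ... | no  i≮ρ =
          subst (ρ ∣ℕ_) a+ρ≡i (ℕ.∣m∣n⇒∣m+n (rec a<i (p∣u[a+ρ]⇒p∣ua a p∣u[a+ρ])) ℕ.∣-refl)
          where
          a = suc i ℕ.∸ ρ
          a+ρ≡i : a ℕ.+ ρ ≡ suc i
          a+ρ≡i = ℕ.m∸n+n≡m (ℕ.≮⇒≥ i≮ρ)
          a<i : a < suc i
          a<i = subst (a <_) a+ρ≡i (ℕ.m<m+n a (ℕ.s≤s ℕ.z≤n))
          p∣u[a+ρ] : + p ∣ u (suc (a ℕ.+ s))
          p∣u[a+ρ] = subst (λ j → + p ∣ u j) (sym (trans (sym (ℕ.+-suc a s)) a+ρ≡i)) p∣

      multiple-of-rank : ∀ {i} → ρ ∣ℕ i → + p ∣ u i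
      multiple-of-rank (ℕ.divides zero    refl) = p ℕ.∣0
      multiple-of-rank (ℕ.divides (suc k) refl) with Lifting.lift s p∣uρ k
      ... | _ , _ , u[kρ]≡ , _ =
        subst (p ∣ℕ_) (sym (trans (cong ∣_∣ u[kρ]≡) (abs-* (u ρ) _))) (ℕ.∣m⇒∣m*n _ p∣uρ)

      p∤u[1+m] : ∀ {m} → ρ ∣ℕ m → ¬ (+ p ∣ u (suc m))
      p∤u[1+m] {m} ρ∣m p∣ = ℕ.<⇒≢ (ℕ.s≤s 1≤s) (sym (ℕ.∣1⇒≡1 ρ∣1))
        where
        ρ∣1 : ρ ∣ℕ 1
        ρ∣1 = ℕ.∣m+n∣m⇒∣n (subst (ρ ∣ℕ_) (ℕ.+-comm 1 m) (rank-divides (suc m) p∣)) ρ∣m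

      valuation-non-multiple : ∀ {i} → ¬ ρ ∣ℕ i → IsValuation ∣ u i ∣ 0
      valuation-non-multiple {i} ρ∤i =
        factorisation ∣ u i ∣ (sym (ℕ.*-identityˡ _)) (ρ∤i ∘ rank-divides i)

      valuation-coprime-multiple : ∀ {m t a} → ρ ∣ℕ m → ¬ p ∣ℕ t →
                                   IsValuation ∣ u m ∣ a → IsValuation ∣ u (t ℕ.* m) ∣ a
      valuation-coprime-multiple {zero}            _   _   v = contradiction v ¬isValuation-0
      valuation-coprime-multiple {suc _} {zero}    _   p∤0 _ = contradiction (p ℕ.∣0) p∤0
      valuation-coprime-multiple {suc s′} {suc k} {a} ρ∣m p∤t v with Lifting.lift s′ (multiple-of-rank ρ∣m) k
      ... | x , _ , u[tm]≡ , _ =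
        subst₂ IsValuation (sym (trans (cong ∣_∣ u[tm]≡) (abs-* (u (suc s′)) z))) (ℕ.+-identityʳ a)
               (isValuation-* v (factorisation ∣ z ∣ (sym (ℕ.*-identityˡ _)) p∤z))
        where
        A = u (suc (suc s′))
        z = + suc k * A ^ k + + p * x
        p∣px : + p ∣ + p * x
        p∣px = subst (p ∣ℕ_) (sym (abs-* (+ p) x)) (ℕ.m∣m*n ∣ x ∣)
        p∤z : ¬ (+ p ∣ z)
        p∤z p∣z with p∣*⇒p∣⊎p∣ (+ suc k) (A ^ k) (∣m+n∣n⇒∣m (+ p) (+ suc k * A ^ k) (+ p * x) p∣z p∣px)
        ... | inj₁ p∣t   = p∤t p∣t
        ... | inj₂ p∣A^k = p∤u[1+m] ρ∣m (p∣^⇒p∣ A k p∣A^k)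

      valuation-p-multiple : ∀ {m a b} → ρ ∣ℕ m →
                             IsValuation ∣ u m ∣ a → IsValuation ∣ u (p ℕ.* m) ∣ b → a < b
      valuation-p-multiple {zero}   _ va _ = contradiction va ¬isValuation-0
      valuation-p-multiple {suc s′} {a} ρ∣m va vb with Lifting.lift s′ (multiple-of-rank ρ∣m) (ℕ.pred p)
      ... | x , _ , u[pm]≡ , _ = p^∣⇒≤ vb (subst (p ℕ.^ suc a ∣ℕ_) (sym ∣u[pm]∣≡) p^[1+a]∣)
        where
        A = u (suc (suc s′))
        z = A ^ ℕ.pred p + x
        u[pm]≡um*pz : u (p ℕ.* suc s′) ≡ u (suc s′) * (+ p * z)
        u[pm]≡um*pz = begin
          u (p ℕ.* suc s′)
            ≡⟨ cong (λ q → u (q ℕ.* suc s′)) (ℕ.suc-pred p) ⟨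
          u (suc (ℕ.pred p) ℕ.* suc s′)
            ≡⟨ u[pm]≡ ⟩
          u (suc s′) * (+ suc (ℕ.pred p) * A ^ ℕ.pred p + + p * x)
            ≡⟨ cong (λ q → u (suc s′) * (+ q * A ^ ℕ.pred p + + p * x)) (ℕ.suc-pred p) ⟩
          u (suc s′) * (+ p * A ^ ℕ.pred p + + p * x)
            ≡⟨ cong (u (suc s′) *_) (*-distribˡ-+ (+ p) (A ^ ℕ.pred p) x) ⟨
          u (suc s′) * (+ p * z)
            ∎
          where open import Data.Integer.Properties using (*-distribˡ-+)
        ∣u[pm]∣≡ : ∣ u (p ℕ.* suc s′) ∣ ≡ ∣ u (suc s′) ∣ ℕ.* (p ℕ.* ∣ z ∣)
        ∣u[pm]∣≡ = trans (cong ∣_∣ u[pm]≡um*pz)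
                   (trans (abs-* (u (suc s′)) (+ p * z)) (cong (∣ u (suc s′) ∣ ℕ.*_) (abs-* (+ p) z)))
        p^[1+a]∣ : p ℕ.^ suc a ∣ℕ ∣ u (suc s′) ∣ ℕ.* (p ℕ.* ∣ z ∣)
        p^[1+a]∣ = subst (_∣ℕ ∣ u (suc s′) ∣ ℕ.* (p ℕ.* ∣ z ∣)) (ℕ.*-comm (p ℕ.^ a) p)
                         (ℕ.*-pres-∣ (≤⇒p^∣ va ℕ.≤-refl) (ℕ.m∣m*n ∣ z ∣))

module ValuationOfC (P Q : ℤ) (p : ℕ) (prime : Prime p) where
  open import Defs
  open import Data.Nat
  open import Data.Nat.Properties
  open import Data.Nat.Divisibility using () renaming (_∣_ to _∣ℕ_)
  open import Data.Nat.Tactic.RingSolver using (solve-∀)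
  open import Data.Integer as ℤ using (+_; ∣_∣)
  open import Data.Integer.Properties using (abs-*; ∣i∣≡0⇒i≡0)
  open import Data.Integer.Divisibility using (_∣_)
  open import Data.Product using (proj₁; proj₂; _,_)
  open import Function using (_∘_)
  open import Relation.Nullary using (¬_; yes; no; contradiction)
  open import Relation.Binary.PropositionalEquality
  open Sum
  open Valuation p prime
  open Lucas P Q
  open AtPrime p prime

  ∣^∣ : ∀ x c → ∣ x ℤ.^ c ∣ ≡ ∣ x ∣ ^ c
  ∣^∣ x zero    = refl
  ∣^∣ x (suc c) = trans (abs-* x (x ℤ.^ c)) (cong (∣ x ∣ *_) (∣^∣ x c))

  Val⇒≡ : ∀ {z i a} → Val p z i → IsValuation ∣ z ∣ a → i ≡ a
  Val⇒≡ {z} {i} {a} (p^i∣z , p^[1+i]∤z) v = ≤-antisym i≤a a≤i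
    where
    i≤a : i ≤ a
    i≤a = p^∣⇒≤ v (subst (_∣ℕ ∣ z ∣) (∣^∣ (+ p) i) p^i∣z)
    a≤i : a ≤ i
    a≤i with a ≤? i
    ... | yes a≤i = a≤i
    ... | no  a≰i =
      contradiction (subst (_∣ℕ ∣ z ∣) (sym (∣^∣ (+ p) (suc i))) (≤⇒p^∣ v (≰⇒> a≰i))) p^[1+i]∤z

  valNonneg : ∀ {x y a b} → IsValuation ∣ x ∣ a → IsValuation ∣ y ∣ b → b ≤ a → ValNonneg p x y
  valNonneg {x} {y} vx vy b≤a i k vali valk = subst₂ _≤_ (sym (Val⇒≡ {y} valk vy)) (sym (Val⇒≡ {x} vali vx)) b≤a

  module Nonvanishing (U≢0 : ∀ n → U P Q (suc n) ≢ + 0) where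

    -- U 0 = 0 has no valuation: w 0 is a junk value.
    w : ℕ → ℕ
    w zero    = 0
    w (suc i) = proj₁ (valuation ∣ u (suc i) ∣ (U≢0 i ∘ ∣i∣≡0⇒i≡0))

    w-isValuation : ∀ i → i ≢ 0 → IsValuation ∣ u i ∣ (w i)
    w-isValuation zero    0≢0 = contradiction refl 0≢0
    w-isValuation (suc i) _   = proj₂ (valuation ∣ u (suc i) ∣ (U≢0 i ∘ ∣i∣≡0⇒i≡0))

    w≡ : ∀ i {a} → IsValuation ∣ u i ∣ a → w i ≡ a
    w≡ zero    v = contradiction v ¬isValuation-0
    w≡ (suc i) v = isValuation-unique (w-isValuation (suc i) (λ ())) v

    fact-valuation : ∀ n → IsValuation ∣ fact P Q n ∣ (∑[ i < n ] w (suc i))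
    fact-valuation zero    = isValuation-1
    fact-valuation (suc n) = subst₂ IsValuation (sym (abs-* (u (suc n)) (fact P Q n))) (+-comm (w (suc n)) _)
                                    (isValuation-* (w-isValuation (suc n) (λ ())) (fact-valuation n))

    Cden-valuation : ∀ l n → IsValuation ∣ Cden P Q l n ∣ (l * w (suc n) + suc l * ∑[ i < n ] w (suc i))
    Cden-valuation l n =
      subst (λ x → IsValuation x (l * w (suc n) + suc l * ∑[ i < n ] w (suc i))) (sym ∣Cden∣≡)
        (isValuation-* (isValuation-^ (w-isValuation (suc n) (λ ())) l) (isValuation-^ (fact-valuation n) (suc l)))
      where
      ∣Cden∣≡ : ∣ Cden P Q l n ∣ ≡ ∣ u (suc n) ∣ ^ l * ∣ fact P Q n ∣ ^ suc l
      ∣Cden∣≡ = trans (abs-* (u (suc n) ℤ.^ l) _) (cong₂ _*_ (∣^∣ (u (suc n)) l) (∣^∣ (fact P Q n) (suc l)))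

    module Inequality (p∤Q : ¬ (+ p ∣ Q)) (t r : ℕ) (rank : IsRank P Q p (suc (t + r)))
                      (uρ-val : Val p (U P Q (suc (t + r))) 1) where
      open Rank p∤Q (t + r) rank
      open import Data.Nat.Divisibility using (n∣m*n)

      p^aρ≢0 : ∀ a → p ^ a * ρ ≢ 0
      p^aρ≢0 a = ≢-nonZero⁻¹ _ {{m*n≢0 (p ^ a) ρ {{m^n≢0 p a}}}}

      h : ℕ → ℕ
      h k = w (k * ρ)

      h-val : ∀ {k a} → IsValuation k a → h k ≡ h (p ^ a)
      h-val {a = a} (factorisation t′ refl p∤t′) = trans (cong w (reassoc (p ^ a) t′ ρ))
        (w≡ (t′ * (p ^ a * ρ)) (valuation-coprime-multiple (n∣m*n (p ^ a)) p∤t′ (w-isValuation (p ^ a * ρ) (p^aρ≢0 a))))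
        where
        reassoc : ∀ x t ρ → x * t * ρ ≡ t * (x * ρ)
        reassoc = solve-∀

      h-step : ∀ a → h (p ^ a) < h (p ^ suc a)
      h-step a = subst (λ j → w (p ^ a * ρ) < w j) (sym (*-assoc p (p ^ a) ρ))
        (valuation-p-multiple (n∣m*n (p ^ a)) (w-isValuation _ (p^aρ≢0 a))
                              (w-isValuation _ (subst (_≢ 0) (*-assoc p (p ^ a) ρ) (p^aρ≢0 (suc a)))))

      h-1 : h 1 ≤ 1
      h-1 = ≤-reflexive (trans (cong w (*-identityˡ ρ)) (w≡ ρ uρ-isValuation))
        where
        uρ-isValuation : IsValuation ∣ u ρ ∣ 1
        uρ-isValuation with valuation ∣ u ρ ∣ (U≢0 (t + r) ∘ ∣i∣≡0⇒i≡0)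
        ... | _ , v = subst (IsValuation _) (sym (Val⇒≡ {u ρ} uρ-val v)) v

      w-non-multiple : ∀ i → ¬ ρ ∣ℕ i → w i ≡ 0
      w-non-multiple i ρ∤i = w≡ i (valuation-non-multiple ρ∤i)

      open LegendreInequality p prime h h-val h-step h-1

      valuation-inequality : ∀ N' → p ≤ ρ + t → (N' ≡ 0 → ρ + t ≢ p) →
        (ρ + t) * w (suc (N' * ρ + (t + r))) + suc (ρ + t) * ∑[ i < N' * ρ + (t + r) ] w (suc i)
        ≤ ∑[ i < suc (ρ + t) * (N' * ρ + (t + r)) ] w (suc i)
      valuation-inequality N' p≤l exception = begin
        l * w (suc n) + suc l * ∑[ i < n ] w (suc i)
          ≡⟨ cong₂ (λ x y → l * x + suc l * y) (cong w 1+n≡) (∑-multiples w w-non-multiple N' ≤-refl) ⟩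
        l * h (suc N') + suc l * ∑[ k < N' ] h (suc k)
          ≤⟨ legendre-inequality p≤l exception (2+M≡ N' t r) ⟩
        ∑[ k < M ] h (suc k)
          ≡⟨ ∑-multiples w w-non-multiple M (s≤s (m≤n+m r t)) ⟨
        ∑[ i < M * ρ + r ] w (suc i)
          ≡⟨ cong (λ m → ∑[ i < m ] w (suc i)) (index N' t r) ⟨
        ∑[ i < suc l * n ] w (suc i)
          ∎
        where
        open ≤-Reasoning
        l = ρ + t
        n = N' * ρ + (t + r)
        M = suc l * N' + (t + t + r)
        1+n≡ : suc n ≡ suc N' * ρ
        1+n≡ = cong suc (+-comm (N' * ρ) (t + r))
        2+M≡ : ∀ N' t r → let ρ = suc (t + r); l = ρ + t in 2 + (suc l * N' + (t + t + r)) ≡ suc l * suc N'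
        2+M≡ = solve-∀
        index : ∀ N' t r → let ρ = suc (t + r); l = ρ + t in
                suc l * (N' * ρ + (t + r)) ≡ (suc l * N' + (t + t + r)) * ρ + r
        index = solve-∀

open import Defs
open import Data.Nat using (ℕ; _+_; _*_; _∸_; _^_; _≤_; _<_; _⊔_)
open import Data.Integer using (ℤ; +_; _-_)
open import Data.Integer.Divisibility using (_∣_)
open import Data.Nat.Divisibility using () renaming (_∣_ to _∣ℕ_)
open import Data.Nat.Primality using (Prime)
open import Data.Product using (_×_)
open import Data.Sum using (_⊎_)
open import Relation.Nullary using (¬_)
open import Relation.Binary.PropositionalEquality using (_≡_)

open import Data.Nat using (suc; pred; s≤s; z≤n; NonZero; >-nonZero)
open import Data.Nat.Properties
open import Data.Nat.Primality using (prime⇒nonZero)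
open import Data.Nat.Tactic.RingSolver using (solve-∀)
import Data.Integer as ℤ
import Data.Integer.Properties as ℤ
open import Data.Product using (_,_; ∃₂)
open import Data.Sum using (inj₁; inj₂)
open import Relation.Nullary using (contradiction)
open import Relation.Binary.PropositionalEquality using (_≢_; refl; sym; trans; cong; module ≡-Reasoning)

split-range : ∀ {ρ l} → ρ ≤ l → l < 2 * ρ → ∃₂ λ t r → l ≡ ρ + t × ρ ≡ suc (t + r)
split-range {ρ} {l} ρ≤l l<2ρ = l ∸ ρ , ρ ∸ suc (l ∸ ρ) , sym (m+[n∸m]≡n ρ≤l) , sym (m+[n∸m]≡n t<ρ)
  where
  t<ρ : l ∸ ρ < ρ
  t<ρ = +-cancelˡ-< ρ (l ∸ ρ) ρ (begin-strict
    ρ + (l ∸ ρ)  ≡⟨ m+[n∸m]≡n ρ≤l ⟩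
    l            <⟨ l<2ρ ⟩
    2 * ρ        ≡⟨ cong (λ x → ρ + x) (+-identityʳ ρ) ⟩
    ρ + ρ        ∎)
    where open ≤-Reasoning

legendre-values : ∀ {p a e} → LegendreSym p a e → e ≡ + 0 ⊎ e ≡ + 1 ⊎ e ≡ ℤ.- + 1
legendre-values (odd-zero _ _)    = inj₁ refl
legendre-values (two-zero _ _)    = inj₁ refl
legendre-values (odd-plus _ _ _)  = inj₂ (inj₁ refl)
legendre-values (two-plus _ _)    = inj₂ (inj₁ refl)
legendre-values (odd-minus _ _ _) = inj₂ (inj₂ refl)
legendre-values (two-minus _ _)   = inj₂ (inj₂ refl)

exception-cases : ∀ {p a e ρ l} → LegendreSym p a e → + ρ ≡ + p - e → 1 ≤ ρ → ρ ≤ l → l ≡ p →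
                  (ρ ≡ p × p ≡ l) ⊎ (ρ ≡ p ∸ 1 × l ≡ p)
exception-cases legendre ρ≡p-e 1≤ρ ρ≤l refl with legendre-values legendre
... | inj₁ refl        = inj₁ (trans (ℤ.+-injective ρ≡p-e) (+-identityʳ _) , refl)
... | inj₂ (inj₁ refl) = inj₂ (ℤ.+-injective (trans ρ≡p-e (ℤ.⊖-≥ (≤-trans 1≤ρ ρ≤l))) , refl)
... | inj₂ (inj₂ refl) =
  contradiction (≤-trans (≤-reflexive (trans (+-comm 1 _) (sym (ℤ.+-injective ρ≡p-e)))) ρ≤l) (n≮n _)

λρp^j∸1≡[λp^j∸1]ρ+[ρ∸1] : ∀ {p} .{{_ : NonZero p}} λ' j t r → 1 ≤ λ' →
  λ' * suc (t + r) * p ^ j ∸ 1 ≡ pred (λ' * p ^ j) * suc (t + r) + (t + r)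
λρp^j∸1≡[λp^j∸1]ρ+[ρ∸1] {p} λ' j t r 1≤λ' = begin
  λ' * ρ * p ^ j ∸ 1    ≡⟨ cong (_∸ 1) (trans (reorder λ' ρ (p ^ j)) (cong (_* ρ) (sym (suc-pred N)))) ⟩
  suc (pred N) * ρ ∸ 1  ≡⟨ +-comm (t + r) (pred N * ρ) ⟩
  pred N * ρ + (t + r)  ∎
  where
  open ≡-Reasoning
  ρ = suc (t + r)
  N = λ' * p ^ j
  instance
    N-nonZero : NonZero N
    N-nonZero = >-nonZero (*-mono-≤ 1≤λ' (m^n>0 p j))
  reorder : ∀ a b c → a * b * c ≡ a * c * b
  reorder = solve-∀

lemma24 : (l : ℕ) (P Q : ℤ) (p ρ j λ' n : ℕ) (e : ℤ) →
    1 ≤ l → DeltaRegular P Q → Prime p → ¬ ((+ p) ∣ Q) →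
    IsRank P Q p ρ →
    1 ≤ λ' → ¬ (p ∣ℕ λ') →
    n ≡ λ' * ρ * p ^ j ∸ 1 →
    LegendreSym p (Disc P Q) e →
    + ρ ≡ + p - e →
    Val p (U P Q ρ) 1 →
    ρ ⊔ p ≤ l → l < 2 * ρ →
    ¬ (n ≡ ρ ∸ 1 × ((ρ ≡ p × p ≡ l) ⊎ (ρ ≡ p ∸ 1 × l ≡ p))) →
    ValNonneg p (Cnum P Q l n) (Cden P Q l n)
lemma24 l P Q p ρ j λ' n e _ (_ , _ , U≢0 , _) p-prime p∤Q rank 1≤λ' _ n≡ legendre ρ≡p-e uρ-val
        ρ⊔p≤l l<2ρ not-exception
  with split-range (m⊔n≤o⇒m≤o ρ p ρ⊔p≤l) l<2ρ
... | t , r , refl , refl with trans n≡ (λρp^j∸1≡[λp^j∸1]ρ+[ρ∸1] {{prime⇒nonZero p-prime}} λ' j t r 1≤λ')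
...   | refl = valNonneg {Cnum P Q l n} {Cden P Q l n}
                 (fact-valuation (suc l * n)) (Cden-valuation l n) (valuation-inequality N' p≤l exception)
  where
  open ValuationOfC P Q p p-prime
  open Nonvanishing U≢0
  open Inequality p∤Q t r rank uρ-val
  N' = pred (λ' * p ^ j)
  p≤l : p ≤ l
  p≤l = m⊔n≤o⇒n≤o ρ p ρ⊔p≤l
  exception : N' ≡ 0 → l ≢ p
  exception N'≡0 l≡p = not-exception (cong (λ x → x * ρ + (t + r)) N'≡0 ,
    exception-cases legendre ρ≡p-e (s≤s z≤n) (m⊔n≤o⇒m≤o ρ p ρ⊔p≤l) l≡p)
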